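{- Let $P=(X,\prec)$ be a finite poset. Then for every integer $t\ge2$, $$\Omega(P,t)^2\ \ge\ \Omega(P,t+1)\cdot\Omega(P,t-1).$$
   Context: $\Omega(P,t)$ is the number of maps $g:X\to[t]$ with $g(x)\le g(y)$ whenever $x\prec y$. -}

module Defs where

open import Level using (Level)
open import Data.Nat using (ℕ; zero; suc)
open import Data.Fin using (Fin; zero; suc; _≤_; _≤?_)
open import Data.Fin.Properties using (all?)
open import Data.List using (List; []; _∷_; concatMap; map; length; filter)
open import Relation.Binary using (Rel; Decidable; IsStrictPartialOrder)
open import Relation.Binary.PropositionalEquality using (_≡_)
open import Relation.Nullary using (Dec; yes; no)
open import Relation.Nullary.Decidable using (_→-dec_)

record FinPoset : Set₁ where
  field
    size  : ℕ
    _≺_   : Rel (Fin size) Level.zero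
    isSPO : IsStrictPartialOrder _≡_ _≺_
    _≺?_  : Decidable _≺_

allMaps : (n t : ℕ) → List (Fin n → Fin t)
allMaps zero    t = (λ ()) ∷ []
allMaps (suc n) t =
  concatMap (λ g → map (λ (a : Fin t) → λ { zero → a ; (suc i) → g i }) (Data.List.allFin t)) (allMaps n t)
  where import Data.List

OrderPreserving : (P : FinPoset) {t : ℕ} → (Fin (FinPoset.size P) → Fin t) → Set
OrderPreserving P g = ∀ x y → x ≺ y → g x ≤ g y
  where open FinPoset P

orderPreserving? : (P : FinPoset) {t : ℕ} → (g : Fin (FinPoset.size P) → Fin t) → Dec (OrderPreserving P g)
orderPreserving? P g = all? λ x → all? λ y → (x ≺? y) →-dec (g x ≤? g y)
  where open FinPoset P

-- Ω(P,t): number of order-preserving maps X → [t], [t] = Fin t = {1,…,t} (order-isomorphic).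
Ω : FinPoset → ℕ → ℕ
Ω P t = length (filter (orderPreserving? P) (allMaps (FinPoset.size P) t))

-- Order-preserving maps X → {0,…,t} form a sublattice of the distributive lattice {0,…,t}^X
-- (pointwise max and min). Apply the Ahlswede–Daykin four functions theorem on this lattice to
-- the indicators of the order-preserving maps with values in {0,…,t} (α), in {1,…,t−1} (β),
-- in {1,…,t} (γ) and in {0,…,t−1} (δ): if y takes values in {1,…,t−1}, then x ⊔ y takes values
-- in {1,…,t} and x ⊓ y in {0,…,t−1}, so α(x)β(y) ≤ γ(x ⊔ y)δ(x ⊓ y). Shifting values identifies
-- the four sums with Ω(t+1), Ω(t−1), Ω(t), Ω(t). The four functions theorem for a product of
-- chains follows coordinate by coordinate from the case of one chain, which in turn follows by
-- induction on its length from the case of a two-element chain.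

module Submission where

open import Defs
open import Level using (Level; 0ℓ)
open import Data.Bool.Base using (if_then_else_)
open import Data.Fin as Fin using (Fin; zero; suc; toℕ; inject₁)
open import Data.Fin.Properties using (all?; toℕ-inject₁)
import Data.List as List
open List using (List)
import Data.List.Properties as Listₚ
open import Data.Nat as ℕ using (ℕ; zero; suc; _+_; _*_; _∸_; _≤_; _<_; z≤n; s≤s; s≤s⁻¹; _≤?_; _<?_)
import Data.Nat.Properties as ℕₚ
open ℕₚ using (≤-trans; ≤-<-trans; m≤m+n; +-mono-≤; +-monoˡ-≤; +-monoʳ-≤; *-mono-≤; *-cancelˡ-≤;
               +-identityʳ; *-identityˡ; +-comm; m≤n⇒∃[o]m+o≡n; m≤n⊔m; m⊓n≤n)
open import Data.Nat.ListAction using () renaming (sum to sumList)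
open import Data.Nat.ListAction.Properties using (sum-++)
open import Data.Nat.Tactic.RingSolver using (solve-∀)
open import Data.Product using (_×_; _,_; proj₁; proj₂; uncurry)
open import Data.Vec.Functional using (Vector; []; _∷_; map; zipWith)
open import Function.Base using (_∘_)
open import Function.Bundles using (_⇔_; mk⇔; Equivalence)
import Function.Properties.Equivalence as ⇔
open import Relation.Binary.PropositionalEquality
open import Relation.Nullary using (Dec; does; yes; no; _×-dec_; contradiction)
open import Relation.Nullary.Decidable using (does-⇔)
open import Relation.Unary using (Pred; Decidable)
open import Algebra.Properties.Semiring.Sum ℕₚ.+-*-semiring
  using (sum; sum-syntax; sum-cong-≗; *-distribˡ-sum; *-distribʳ-sum)
open import Algebra.Properties.CommutativeSemigroup ℕₚ.*-commutativeSemigroup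
  using (xy∙z≈y∙xz)

open Equivalence using (to; from)

private
  variable
    ℓ : Level
    k m n : ℕ

sum-mono-≤ : {f g : Vector ℕ n} → (∀ i → f i ≤ g i) → sum f ≤ sum g
sum-mono-≤ {zero}  _   = z≤n
sum-mono-≤ {suc n} f≤g = +-mono-≤ (f≤g zero) (sum-mono-≤ (f≤g ∘ suc))

𝟙 : {A : Set ℓ} → Dec A → ℕ
𝟙 a? = if does a? then 1 else 0

𝟙-×-dec : ∀ {ℓ′} {A : Set ℓ} {B : Set ℓ′} (a? : Dec A) (b? : Dec B) → 𝟙 (a? ×-dec b?) ≡ 𝟙 a? * 𝟙 b?
𝟙-×-dec (yes _) b? = sym (+-identityʳ (𝟙 b?))
𝟙-×-dec (no _)  b? = refl

𝟙-⇔ : ∀ {ℓ′} {A : Set ℓ} {B : Set ℓ′} → A ⇔ B → (a? : Dec A) (b? : Dec B) → 𝟙 a? ≡ 𝟙 b?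
𝟙-⇔ A⇔B a? b? = cong (if_then 1 else 0) (does-⇔ A⇔B a? b?)

𝟙-mono : ∀ {ℓ′} {A : Set ℓ} {B : Set ℓ′} → (A → B) → (a? : Dec A) (b? : Dec B) → 𝟙 a? ≤ 𝟙 b?
𝟙-mono A→B (yes _) (yes _) = ℕₚ.≤-refl
𝟙-mono A→B (yes a) (no ¬b) = contradiction (A→B a) ¬b
𝟙-mono A→B (no _)  b?      = z≤n

𝟙-*-mono : ∀ {A B C D : Set ℓ} → (A → B → C × D) →
  (a? : Dec A) (b? : Dec B) (c? : Dec C) (d? : Dec D) → 𝟙 a? * 𝟙 b? ≤ 𝟙 c? * 𝟙 d?
𝟙-*-mono impl a? b? c? d? = begin
  𝟙 a? * 𝟙 b?         ≡⟨ 𝟙-×-dec a? b? ⟨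
  𝟙 (a? ×-dec b?)     ≤⟨ 𝟙-mono (uncurry impl) (a? ×-dec b?) (c? ×-dec d?) ⟩
  𝟙 (c? ×-dec d?)     ≡⟨ 𝟙-×-dec c? d? ⟩
  𝟙 c? * 𝟙 d?         ∎
  where open ℕₚ.≤-Reasoning

-- Without function extensionality, sums over maps can only be rearranged for summands respecting ≗.

Extensional : (Vector (Fin m) n → ℕ) → Set
Extensional F = ∀ {f g} → f ≗ g → F f ≡ F g

sumHead : (Vector (Fin m) (suc n) → ℕ) → Vector (Fin m) n → ℕ
sumHead {m} F g = ∑[ a < m ] F (a ∷ g)

sumMaps : ∀ n m → (Vector (Fin m) n → ℕ) → ℕ
sumMaps zero    m F = F []
sumMaps (suc n) m F = sumMaps n m (sumHead F)

sumMaps-cong : ∀ n {F G : Vector (Fin m) n → ℕ} → (∀ g → F g ≡ G g) → sumMaps n m F ≡ sumMaps n m G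
sumMaps-cong zero    F≗G = F≗G []
sumMaps-cong (suc n) F≗G = sumMaps-cong n (λ g → sum-cong-≗ (λ a → F≗G (a ∷ g)))

∷-cong : (a : Fin m) {f g : Vector (Fin m) n} → f ≗ g → (a ∷ f) ≗ (a ∷ g)
∷-cong a f≗g zero    = refl
∷-cong a f≗g (suc i) = f≗g i

map-∷ : ∀ {A B : Set} (e : A → B) (b : A) (g : Vector A n) → map e (b ∷ g) ≗ e b ∷ map e g
map-∷ e b g zero    = refl
map-∷ e b g (suc i) = refl

sumHead-extensional : {F : Vector (Fin m) (suc n) → ℕ} → Extensional F → Extensional (sumHead F)
sumHead-extensional F-ext f≗g = sum-cong-≗ (λ a → F-ext (∷-cong a f≗g))

sumList-concatMap : ∀ {A B : Set} (F : B → ℕ) (h : A → List B) (xs : List A) →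
  sumList (List.map F (List.concatMap h xs)) ≡ sumList (List.map (sumList ∘ List.map F ∘ h) xs)
sumList-concatMap F h List.[]       = refl
sumList-concatMap F h (x List.∷ xs) = begin
  sumList (List.map F (h x List.++ List.concatMap h xs))
    ≡⟨ cong sumList (Listₚ.map-++ F (h x) _) ⟩
  sumList (List.map F (h x) List.++ List.map F (List.concatMap h xs))
    ≡⟨ sum-++ (List.map F (h x)) _ ⟩
  sumList (List.map F (h x)) + sumList (List.map F (List.concatMap h xs))
    ≡⟨ cong (sumList (List.map F (h x)) +_) (sumList-concatMap F h xs) ⟩
  sumList (List.map (sumList ∘ List.map F ∘ h) (x List.∷ xs)) ∎
  where open ≡-Reasoning

sumList-tabulate : (f : Fin m → ℕ) → sumList (List.tabulate f) ≡ sum f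
sumList-tabulate {zero}  f = refl
sumList-tabulate {suc m} f = cong (f zero +_) (sumList-tabulate (f ∘ suc))

sumList-allFin : (f : Fin m → ℕ) → sumList (List.map f (List.allFin m)) ≡ sum f
sumList-allFin f = trans (cong sumList (Listₚ.map-tabulate (λ i → i) f)) (sumList-tabulate f)

sumList-allMaps : ∀ n m (F : Vector (Fin m) n → ℕ) → Extensional F →
  sumList (List.map F (allMaps n m)) ≡ sumMaps n m F
sumList-allMaps zero    m F F-ext = trans (+-identityʳ _) (F-ext (λ ()))
sumList-allMaps (suc n) m F F-ext = begin
  sumList (List.map F (allMaps (suc n) m))
    ≡⟨ trans (sumList-concatMap F _ (allMaps n m))
             (cong sumList (Listₚ.map-cong (λ g → sumList-extend g _ λ a → λ { zero → refl ; (suc i) → refl })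
                                           (allMaps n m))) ⟩
  sumList (List.map (sumHead F) (allMaps n m))
    ≡⟨ sumList-allMaps n m (sumHead F) (sumHead-extensional F-ext) ⟩
  sumMaps (suc n) m F ∎
  where
  open ≡-Reasoning
  -- allMaps extends g by a pattern-matching lambda that is only pointwise equal to a ∷ g.
  sumList-extend : (g : Vector (Fin m) n) (extend : Fin m → Vector (Fin m) (suc n)) →
    (∀ a → (a ∷ g) ≗ extend a) →
    sumList (List.map F (List.map extend (List.allFin m))) ≡ sumHead F g
  sumList-extend g extend extend≗ = begin
    sumList (List.map F (List.map extend (List.allFin m))) ≡⟨ cong sumList (Listₚ.map-∘ (List.allFin m)) ⟨
    sumList (List.map (F ∘ extend) (List.allFin m))        ≡⟨ sumList-allFin (F ∘ extend) ⟩
    sum (F ∘ extend)                                       ≡⟨ sum-cong-≗ (λ a → F-ext (extend≗ a)) ⟨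
    sumHead F g                                            ∎

length-filter : {A : Set} {P : Pred A ℓ} (P? : Decidable P) (xs : List A) →
  List.length (List.filter P? xs) ≡ sumList (List.map (𝟙 ∘ P?) xs)
length-filter P? List.[]       = refl
length-filter P? (x List.∷ xs) with P? x
... | yes _ = cong suc (length-filter P? xs)
... | no  _ = length-filter P? xs

_⊔_ : Fin m → Fin m → Fin m
zero  ⊔ j     = j
suc i ⊔ zero  = suc i
suc i ⊔ suc j = suc (i ⊔ j)

_⊓_ : Fin m → Fin m → Fin m
zero  ⊓ j     = zero
suc i ⊓ zero  = zero
suc i ⊓ suc j = suc (i ⊓ j)

toℕ-⊔ : (i j : Fin m) → toℕ (i ⊔ j) ≡ toℕ i ℕ.⊔ toℕ j
toℕ-⊔ zero    j       = refl
toℕ-⊔ (suc i) zero    = refl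
toℕ-⊔ (suc i) (suc j) = cong suc (toℕ-⊔ i j)

toℕ-⊓ : (i j : Fin m) → toℕ (i ⊓ j) ≡ toℕ i ℕ.⊓ toℕ j
toℕ-⊓ zero    j       = refl
toℕ-⊓ (suc i) zero    = refl
toℕ-⊓ (suc i) (suc j) = cong suc (toℕ-⊓ i j)

⊔-mono-≤ : {i i′ j j′ : Fin m} → i Fin.≤ i′ → j Fin.≤ j′ → i ⊔ j Fin.≤ i′ ⊔ j′
⊔-mono-≤ {i = i} {i′} {j} {j′} i≤i′ j≤j′ =
  subst₂ _≤_ (sym (toℕ-⊔ i j)) (sym (toℕ-⊔ i′ j′)) (ℕₚ.⊔-mono-≤ i≤i′ j≤j′)

⊓-mono-≤ : {i i′ j j′ : Fin m} → i Fin.≤ i′ → j Fin.≤ j′ → i ⊓ j Fin.≤ i′ ⊓ j′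
⊓-mono-≤ {i = i} {i′} {j} {j′} i≤i′ j≤j′ =
  subst₂ _≤_ (sym (toℕ-⊓ i j)) (sym (toℕ-⊓ i′ j′)) (ℕₚ.⊓-mono-≤ i≤i′ j≤j′)

zipWith-∷ : ∀ {A B C : Set} (f : A → B → C) (a : A) (b : B) (x : Vector A n) (y : Vector B n) →
  zipWith f (a ∷ x) (b ∷ y) ≗ f a b ∷ zipWith f x y
zipWith-∷ f a b x y zero    = refl
zipWith-∷ f a b x y (suc i) = refl

-- (M − p)(M − q) ≥ 0
square-bound : ∀ {p q M} → p ≤ M → q ≤ M → M * p + M * q ≤ M * M + p * q
square-bound {p} {q} {M} p≤M q≤M
  with (u , p+u≡M) ← m≤n⇒∃[o]m+o≡n p≤M | (v , q+v≡M) ← m≤n⇒∃[o]m+o≡n q≤M = begin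
  M * p + M * q                   ≤⟨ m≤m+n _ (u * v) ⟩
  M * p + M * q + u * v           ≡⟨ cong₂ (λ A B → A * p + B * q + u * v) q+v≡M p+u≡M ⟨
  (q + v) * p + (p + u) * q + u * v ≡⟨ regroup p q u v ⟩
  (p + u) * (q + v) + p * q       ≡⟨ cong₂ (λ A B → A * B + p * q) p+u≡M q+v≡M ⟩
  M * M + p * q                   ∎
  where
  open ℕₚ.≤-Reasoning
  regroup : ∀ p q u v → (q + v) * p + (p + u) * q + u * v ≡ (p + u) * (q + v) + p * q
  regroup = solve-∀

cross-terms-bound : ∀ x₀ x₁ y₀ y₁ M → x₀ * y₁ ≤ M → x₁ * y₀ ≤ M →
  M * ((x₀ + x₁) * (y₀ + y₁)) ≤ (x₀ * y₀ + M) * (M + x₁ * y₁)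
cross-terms-bound x₀ x₁ y₀ y₁ M x₀y₁≤M x₁y₀≤M = begin
  M * ((x₀ + x₁) * (y₀ + y₁))                             ≡⟨ expand-left x₀ x₁ y₀ y₁ M ⟩
  M * (x₀ * y₀ + x₁ * y₁) + (M * (x₀ * y₁) + M * (x₁ * y₀))
    ≤⟨ +-monoʳ-≤ (M * (x₀ * y₀ + x₁ * y₁)) (square-bound x₀y₁≤M x₁y₀≤M) ⟩
  M * (x₀ * y₀ + x₁ * y₁) + (M * M + x₀ * y₁ * (x₁ * y₀)) ≡⟨ expand-right x₀ x₁ y₀ y₁ M ⟨
  (x₀ * y₀ + M) * (M + x₁ * y₁)                           ∎
  where
  open ℕₚ.≤-Reasoning
  expand-left : ∀ x₀ x₁ y₀ y₁ M → M * ((x₀ + x₁) * (y₀ + y₁)) ≡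
    M * (x₀ * y₀ + x₁ * y₁) + (M * (x₀ * y₁) + M * (x₁ * y₀))
  expand-left = solve-∀
  expand-right : ∀ x₀ x₁ y₀ y₁ M → (x₀ * y₀ + M) * (M + x₁ * y₁) ≡
    M * (x₀ * y₀ + x₁ * y₁) + (M * M + x₀ * y₁ * (x₁ * y₀))
  expand-right = solve-∀

fourFunctions₂ : ∀ x₀ x₁ y₀ y₁ z₀ z₁ w₀ w₁ →
  x₀ * y₀ ≤ z₀ * w₀ → x₀ * y₁ ≤ z₁ * w₀ → x₁ * y₀ ≤ z₁ * w₀ → x₁ * y₁ ≤ z₁ * w₁ →
  (x₀ + x₁) * (y₀ + y₁) ≤ (z₀ + z₁) * (w₀ + w₁)
fourFunctions₂ x₀ x₁ y₀ y₁ z₀ z₁ w₀ w₁ h₀₀ h₀₁ h₁₀ h₁₁ with z₁ * w₀ in z₁w₀≡M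
... | zero = begin
  (x₀ + x₁) * (y₀ + y₁)                       ≡⟨ expand x₀ x₁ y₀ y₁ ⟩
  x₀ * y₀ + x₀ * y₁ + (x₁ * y₀ + x₁ * y₁)
    ≤⟨ +-mono-≤ (+-mono-≤ h₀₀ (≤-trans h₀₁ z≤n)) (+-mono-≤ (≤-trans h₁₀ z≤n) h₁₁) ⟩
  z₀ * w₀ + z₀ * w₁ + (z₁ * w₀ + z₁ * w₁)     ≡⟨ expand z₀ z₁ w₀ w₁ ⟨
  (z₀ + z₁) * (w₀ + w₁)                       ∎
  where
  open ℕₚ.≤-Reasoning
  expand : ∀ a b c d → (a + b) * (c + d) ≡ a * c + a * d + (b * c + b * d)
  expand = solve-∀
-- For M = z₁w₀ > 0, compare M times both sides through (x₀y₀ + M)(M + x₁y₁).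
... | M@(suc _) = *-cancelˡ-≤ M (begin
  M * ((x₀ + x₁) * (y₀ + y₁))                 ≤⟨ cross-terms-bound x₀ x₁ y₀ y₁ M h₀₁ h₁₀ ⟩
  (x₀ * y₀ + M) * (M + x₁ * y₁)               ≤⟨ *-mono-≤ (+-monoˡ-≤ M h₀₀) (+-monoʳ-≤ M h₁₁) ⟩
  (z₀ * w₀ + M) * (M + z₁ * w₁)               ≡⟨ cong (λ N → (z₀ * w₀ + N) * (N + z₁ * w₁)) z₁w₀≡M ⟨
  (z₀ * w₀ + z₁ * w₀) * (z₁ * w₀ + z₁ * w₁)   ≡⟨ factor z₀ z₁ w₀ w₁ ⟩
  z₁ * w₀ * ((z₀ + z₁) * (w₀ + w₁))           ≡⟨ cong (_* ((z₀ + z₁) * (w₀ + w₁))) z₁w₀≡M ⟩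
  M * ((z₀ + z₁) * (w₀ + w₁))                 ∎)
  where
  open ℕₚ.≤-Reasoning
  factor : ∀ z₀ z₁ w₀ w₁ → (z₀ * w₀ + z₁ * w₀) * (z₁ * w₀ + z₁ * w₁) ≡ z₁ * w₀ * ((z₀ + z₁) * (w₀ + w₁))
  factor = solve-∀

fourFunctions-chain : ∀ m (a b c d : Fin m → ℕ) → (∀ i j → a i * b j ≤ c (i ⊔ j) * d (i ⊓ j)) →
  sum a * sum b ≤ sum c * sum d
fourFunctions-chain zero    a b c d h = z≤n
-- Split off the bottom element 0, for which 0 ⊔ j = j and 0 ⊓ j = 0.
fourFunctions-chain (suc m) a b c d h =
  fourFunctions₂ (a zero) (sum (a ∘ suc)) (b zero) (sum (b ∘ suc))
                 (c zero) (sum (c ∘ suc)) (d zero) (sum (d ∘ suc))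
    (h zero zero)
    (begin
      a zero * sum (b ∘ suc)          ≡⟨ *-distribˡ-sum (a zero) (b ∘ suc) ⟩
      sum (λ j → a zero * b (suc j))  ≤⟨ sum-mono-≤ (λ j → h zero (suc j)) ⟩
      sum (λ j → c (suc j) * d zero)  ≡⟨ *-distribʳ-sum (d zero) (c ∘ suc) ⟨
      sum (c ∘ suc) * d zero          ∎)
    (begin
      sum (a ∘ suc) * b zero          ≡⟨ *-distribʳ-sum (b zero) (a ∘ suc) ⟩
      sum (λ i → a (suc i) * b zero)  ≤⟨ sum-mono-≤ (λ i → h (suc i) zero) ⟩
      sum (λ i → c (suc i) * d zero)  ≡⟨ *-distribʳ-sum (d zero) (c ∘ suc) ⟨
      sum (c ∘ suc) * d zero          ∎)
    (fourFunctions-chain m (a ∘ suc) (b ∘ suc) (c ∘ suc) (d ∘ suc) (λ i j → h (suc i) (suc j)))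
  where open ℕₚ.≤-Reasoning

fourFunctions : ∀ n m (α β γ δ : Vector (Fin m) n → ℕ) → Extensional γ → Extensional δ →
  (∀ x y → α x * β y ≤ γ (zipWith _⊔_ x y) * δ (zipWith _⊓_ x y)) →
  sumMaps n m α * sumMaps n m β ≤ sumMaps n m γ * sumMaps n m δ
fourFunctions zero m α β γ δ γ-ext δ-ext h =
  subst₂ (λ p q → α [] * β [] ≤ p * q) (γ-ext (λ ())) (δ-ext (λ ())) (h [] [])
fourFunctions (suc n) m α β γ δ γ-ext δ-ext h =
  fourFunctions n m (sumHead α) (sumHead β) (sumHead γ) (sumHead δ)
    (sumHead-extensional γ-ext) (sumHead-extensional δ-ext)
    λ x y → fourFunctions-chain m _ _ _ _ λ i j →
      subst₂ (λ p q → α (i ∷ x) * β (j ∷ y) ≤ p * q)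
             (γ-ext (zipWith-∷ _⊔_ i j x y)) (δ-ext (zipWith-∷ _⊓_ i j x y)) (h (i ∷ x) (j ∷ y))

NotFirst : Pred (Fin m) 0ℓ
NotFirst a = 1 ≤ toℕ a

NotFirst? : Decidable (NotFirst {m})
NotFirst? a = 1 ≤? toℕ a

NotLast : Pred (Fin (suc k)) 0ℓ
NotLast {k} a = toℕ a < k

NotLast? : Decidable (NotLast {k})
NotLast? {k} a = toℕ a <? k

Inner : Pred (Fin (suc k)) 0ℓ
Inner a = NotFirst a × NotLast a

Inner? : Decidable (Inner {k})
Inner? a = NotFirst? a ×-dec NotLast? a

NotFirst-⊔ : (i : Fin m) {j : Fin m} → NotFirst j → NotFirst (i ⊔ j)
NotFirst-⊔ i {j} 1≤j = subst (1 ≤_) (sym (toℕ-⊔ i j)) (≤-trans 1≤j (m≤n⊔m (toℕ i) (toℕ j)))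

NotLast-⊓ : (i : Fin (suc k)) {j : Fin (suc k)} → NotLast j → NotLast (i ⊓ j)
NotLast-⊓ i {j} j<k = subst (_< _) (sym (toℕ-⊓ i j)) (≤-<-trans (m⊓n≤n (toℕ i) (toℕ j)) j<k)

-- e maps Fin k bijectively onto W, stated through the sums it reindexes.
Enumerates : ∀ {m k} {W : Pred (Fin m) ℓ} → Decidable W → (Fin k → Fin m) → Set
Enumerates {m = m} {k = k} W? e = (G : Fin m → ℕ) → ∑[ a < m ] (𝟙 (W? a) * G a) ≡ ∑[ i < k ] G (e i)

suc-enumerates-NotFirst : ∀ {k} → Enumerates (NotFirst? {suc k}) suc
suc-enumerates-NotFirst G = sum-cong-≗ (λ i → *-identityˡ (G (suc i)))

inject₁-enumerates-NotLast : ∀ {k} → Enumerates (NotLast? {k}) inject₁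
inject₁-enumerates-NotLast {zero}  G = refl
inject₁-enumerates-NotLast {suc k} G = cong₂ _+_ (*-identityˡ (G zero)) (inject₁-enumerates-NotLast (G ∘ suc))

suc-inject₁-enumerates-Inner : ∀ {k} → Enumerates (Inner? {suc k}) (suc ∘ inject₁)
suc-inject₁-enumerates-Inner {k} G = inject₁-enumerates-NotLast {k} (G ∘ suc)

OrderEmbedding : (Fin k → Fin m) → Set
OrderEmbedding e = ∀ {i j} → e i Fin.≤ e j ⇔ i Fin.≤ j

suc-orderEmbedding : OrderEmbedding (suc {k})
suc-orderEmbedding = mk⇔ s≤s⁻¹ s≤s

inject₁-orderEmbedding : OrderEmbedding (inject₁ {k})
inject₁-orderEmbedding {i = i} {j} =
  mk⇔ (subst₂ _≤_ (toℕ-inject₁ i) (toℕ-inject₁ j)) (subst₂ _≤_ (sym (toℕ-inject₁ i)) (sym (toℕ-inject₁ j)))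

suc-inject₁-orderEmbedding : OrderEmbedding (suc ∘ inject₁ {k})
suc-inject₁-orderEmbedding = ⇔.trans suc-orderEmbedding inject₁-orderEmbedding

sumMaps-restrict : ∀ n {m k} {W : Pred (Fin m) ℓ} (W? : Decidable W) {e : Fin k → Fin m} →
  Enumerates W? e → (F : Vector (Fin m) n → ℕ) → Extensional F →
  sumMaps n m (λ h → 𝟙 (all? (λ i → W? (h i))) * F h) ≡ sumMaps n k (F ∘ map e)
sumMaps-restrict zero    W? enum F F-ext = trans (*-identityˡ _) (F-ext (λ ()))
sumMaps-restrict (suc n) {m} {k} W? {e} enum F F-ext = begin
  sumMaps n m (sumHead (λ h → 𝟙 (all? (λ i → W? (h i))) * F h))
    ≡⟨ sumMaps-cong n sumHead-restrict ⟩
  sumMaps n m (λ g → 𝟙 (all? (λ i → W? (g i))) * F′ g)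
    ≡⟨ sumMaps-restrict n W? enum F′ (sum-cong-≗ ∘ (λ f≗g b → F-ext (∷-cong (e b) f≗g))) ⟩
  sumMaps n k (F′ ∘ map e)
    ≡⟨ sumMaps-cong n (λ g → sum-cong-≗ (λ b → F-ext (sym ∘ map-∷ e b g))) ⟩
  sumMaps (suc n) k (F ∘ map e) ∎
  where
  open ≡-Reasoning
  F′ : Vector (Fin m) n → ℕ
  F′ g = ∑[ b < k ] F (e b ∷ g)
  sumHead-restrict : ∀ g →
    sumHead (λ h → 𝟙 (all? (λ i → W? (h i))) * F h) g ≡ 𝟙 (all? (λ i → W? (g i))) * F′ g
  sumHead-restrict g = begin
    ∑[ a < m ] (𝟙 (W? a ×-dec all? (λ i → W? (g i))) * F (a ∷ g))
      ≡⟨ sum-cong-≗ (λ a → trans (cong (_* F (a ∷ g)) (𝟙-×-dec (W? a) (all? (λ i → W? (g i)))))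
                                 (xy∙z≈y∙xz (𝟙 (W? a)) _ (F (a ∷ g)))) ⟩
    ∑[ a < m ] (𝟙 (all? (λ i → W? (g i))) * (𝟙 (W? a) * F (a ∷ g)))
      ≡⟨ *-distribˡ-sum (𝟙 (all? (λ i → W? (g i)))) (λ a → 𝟙 (W? a) * F (a ∷ g)) ⟨
    𝟙 (all? (λ i → W? (g i))) * ∑[ a < m ] (𝟙 (W? a) * F (a ∷ g))
      ≡⟨ cong (𝟙 (all? (λ i → W? (g i))) *_) (enum (λ a → F (a ∷ g))) ⟩
    𝟙 (all? (λ i → W? (g i))) * F′ g ∎

module _ (P : FinPoset) where
  open FinPoset P using (size)

  OrderPreservingWithin : Pred (Fin m) ℓ → Pred (Vector (Fin m) size) ℓ
  OrderPreservingWithin W h = (∀ i → W (h i)) × OrderPreserving P h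

  orderPreservingWithin? : {W : Pred (Fin m) ℓ} → Decidable W → Decidable (OrderPreservingWithin W)
  orderPreservingWithin? W? h = all? (λ i → W? (h i)) ×-dec orderPreserving? P h

  orderPreserving-≗ : {f g : Vector (Fin m) size} → f ≗ g → OrderPreserving P f → OrderPreserving P g
  orderPreserving-≗ f≗g f-mono x y x≺y = subst₂ Fin._≤_ (f≗g x) (f≗g y) (f-mono x y x≺y)

  orderPreservingWithin-≗ : {W : Pred (Fin m) ℓ} {f g : Vector (Fin m) size} → f ≗ g →
    OrderPreservingWithin W f → OrderPreservingWithin W g
  orderPreservingWithin-≗ {W = W} f≗g (f∈W , f-mono) =
    (λ i → subst W (f≗g i) (f∈W i)) , orderPreserving-≗ f≗g f-mono

  𝟙-orderPreserving-extensional : Extensional (λ (g : Vector (Fin m) size) → 𝟙 (orderPreserving? P g))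
  𝟙-orderPreserving-extensional {f = f} {g = g} f≗g =
    𝟙-⇔ (mk⇔ (orderPreserving-≗ f≗g) (orderPreserving-≗ (sym ∘ f≗g)))
        (orderPreserving? P f) (orderPreserving? P g)

  𝟙-orderPreservingWithin-extensional : {W : Pred (Fin m) ℓ} (W? : Decidable W) →
    Extensional (𝟙 ∘ orderPreservingWithin? W?)
  𝟙-orderPreservingWithin-extensional {W = W} W? {f} {g} f≗g =
    𝟙-⇔ (mk⇔ (orderPreservingWithin-≗ {W = W} f≗g) (orderPreservingWithin-≗ {W = W} (sym ∘ f≗g)))
        (orderPreservingWithin? W? f) (orderPreservingWithin? W? g)

  orderPreserving-map : {e : Fin k → Fin m} → OrderEmbedding e → (g : Vector (Fin k) size) →
    OrderPreserving P (map e g) ⇔ OrderPreserving P g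
  orderPreserving-map e-emb g =
    mk⇔ (λ eg-mono x y x≺y → to e-emb (eg-mono x y x≺y)) (λ g-mono x y x≺y → from e-emb (g-mono x y x≺y))

  orderPreserving-⊔ : {f g : Vector (Fin m) size} → OrderPreserving P f → OrderPreserving P g →
    OrderPreserving P (zipWith _⊔_ f g)
  orderPreserving-⊔ f-mono g-mono x y x≺y = ⊔-mono-≤ (f-mono x y x≺y) (g-mono x y x≺y)

  orderPreserving-⊓ : {f g : Vector (Fin m) size} → OrderPreserving P f → OrderPreserving P g →
    OrderPreserving P (zipWith _⊓_ f g)
  orderPreserving-⊓ f-mono g-mono x y x≺y = ⊓-mono-≤ (f-mono x y x≺y) (g-mono x y x≺y)

  Ω≡sumMaps : ∀ t → Ω P t ≡ sumMaps size t (λ g → 𝟙 (orderPreserving? P g))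
  Ω≡sumMaps t = trans (length-filter (orderPreserving? P) (allMaps size t))
                      (sumList-allMaps size t _ 𝟙-orderPreserving-extensional)

  Ω≡sumMaps-within : ∀ {m k} {W : Pred (Fin m) ℓ} (W? : Decidable W) {e : Fin k → Fin m} →
    Enumerates W? e → OrderEmbedding e → Ω P k ≡ sumMaps size m (𝟙 ∘ orderPreservingWithin? W?)
  Ω≡sumMaps-within {m = m} {k = k} W? {e} enum e-emb = sym (begin
    sumMaps size m (𝟙 ∘ orderPreservingWithin? W?)
      ≡⟨ sumMaps-cong size (λ h → 𝟙-×-dec (all? (λ i → W? (h i))) (orderPreserving? P h)) ⟩
    sumMaps size m (λ h → 𝟙 (all? (λ i → W? (h i))) * 𝟙 (orderPreserving? P h))
      ≡⟨ sumMaps-restrict size W? enum _ 𝟙-orderPreserving-extensional ⟩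
    sumMaps size k (λ g → 𝟙 (orderPreserving? P (map e g)))
      ≡⟨ sumMaps-cong size (λ g → 𝟙-⇔ (orderPreserving-map e-emb g)
                                      (orderPreserving? P (map e g)) (orderPreserving? P g)) ⟩
    sumMaps size k (λ g → 𝟙 (orderPreserving? P g))
      ≡⟨ Ω≡sumMaps k ⟨
    Ω P k ∎)
    where open ≡-Reasoning

  lattice-closure : (x y : Vector (Fin (suc k)) size) →
    OrderPreserving P x → OrderPreservingWithin Inner y →
    OrderPreservingWithin NotFirst (zipWith _⊔_ x y) × OrderPreservingWithin NotLast (zipWith _⊓_ x y)
  lattice-closure x y x-mono (y-inner , y-mono) =
      ((λ i → NotFirst-⊔ (x i) (proj₁ (y-inner i))) , orderPreserving-⊔ x-mono y-mono)
    , ((λ i → NotLast-⊓ (x i) (proj₂ (y-inner i))) , orderPreserving-⊓ x-mono y-mono)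

  Ω-logConcave : ∀ k → Ω P (2 + k) * Ω P k ≤ Ω P (1 + k) * Ω P (1 + k)
  Ω-logConcave k = begin
    Ω P (2 + k) * Ω P k
      ≡⟨ cong₂ _*_ (Ω≡sumMaps (2 + k))
                   (Ω≡sumMaps-within Inner? suc-inject₁-enumerates-Inner suc-inject₁-orderEmbedding) ⟩
    sumMaps size (2 + k) (λ g → 𝟙 (orderPreserving? P g)) *
    sumMaps size (2 + k) (𝟙 ∘ orderPreservingWithin? Inner?)
      ≤⟨ fourFunctions size (2 + k) _ _ _ _
           (𝟙-orderPreservingWithin-extensional NotFirst?) (𝟙-orderPreservingWithin-extensional NotLast?)
           (λ x y → 𝟙-*-mono (lattice-closure x y)
                      (orderPreserving? P x) (orderPreservingWithin? Inner? y)
                      (orderPreservingWithin? NotFirst? (zipWith _⊔_ x y))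
                      (orderPreservingWithin? NotLast? (zipWith _⊓_ x y))) ⟩
    sumMaps size (2 + k) (𝟙 ∘ orderPreservingWithin? NotFirst?) *
    sumMaps size (2 + k) (𝟙 ∘ orderPreservingWithin? NotLast?)
      ≡⟨ cong₂ _*_ (Ω≡sumMaps-within NotFirst? suc-enumerates-NotFirst suc-orderEmbedding)
                   (Ω≡sumMaps-within NotLast? inject₁-enumerates-NotLast inject₁-orderEmbedding) ⟨
    Ω P (1 + k) * Ω P (1 + k) ∎
    where open ℕₚ.≤-Reasoning

theorem4p7 : (P : FinPoset) (t : ℕ) → 2 ≤ t →
    Ω P (t + 1) * Ω P (t ∸ 1) ≤ Ω P t * Ω P t
theorem4p7 P (suc (suc s)) _ =
  subst (λ u → Ω P u * Ω P (suc s) ≤ Ω P (2 + s) * Ω P (2 + s)) (+-comm 1 (2 + s)) (Ω-logConcave P (suc s))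
theorem4p7 P 1 (s≤s ())
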